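{- For every integer $k\ge 3$, the cycle $C_k$ is an ENPT graph; that is, there exist a tree $T$ and a set $\mathcal{P}$ of non-trivial simple paths in $T$ such that $\mathrm{ENPT}(T,\mathcal{P})$ is isomorphic to $C_k$.
   Context: Given a tree $T$ and a set $\mathcal{P}=\{P_v\}$ of non-trivial simple paths in $T$ (each with at least one edge), two paths $P,P'$ are non-splitting if they share at least one edge and no vertex has degree at least $3$ in their union $P\cup P'$ (equivalently, $P\cup P'$ is a path). The graph $\mathrm{ENPT}(T,\mathcal{P})$ has a vertex $v$ for each path $P_v\in\mathcal{P}$, with $u,v$ adjacent iff $P_u$ and $P_v$ are non-splitting. A graph $G$ is an ENPT graph if it is isomorphic to $\mathrm{ENPT}(T,\mathcal{P})$ for some such $T,\mathcal{P}$. -}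

module Defs where

open import Level using (0ℓ)
open import Data.Nat using (ℕ; zero; suc)
open import Data.Fin using (Fin; zero; suc; inject₁; fromℕ; toℕ)
open import Data.Product using (Σ; ∃; _×_; _,_)
open import Data.Sum using (_⊎_)
open import Data.Empty using (⊥)
open import Relation.Nullary using (¬_)
open import Relation.Binary.PropositionalEquality using (_≡_; _≢_)
open import Function.Definitions using (Injective)
open import Function.Bundles using (_⇔_; _⤖_; Bijection)

record Graph (m : ℕ) : Set₁ where
  field
    Adj   : Fin m → Fin m → Set
    sym   : ∀ {x y} → Adj x y → Adj y x
    irrefl : ∀ {x} → ¬ Adj x x
open Graph public

-- A (non-trivial) simple path in G: pairwise distinct vertices
-- v₀ … v_{len+1} (so at least one edge), consecutive ones adjacent.
record Path {m : ℕ} (G : Graph m) : Set where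
  field
    len      : ℕ
    vtx      : Fin (suc (suc len)) → Fin m
    distinct : Injective _≡_ _≡_ vtx
    adjacent : ∀ (i : Fin (suc len)) → Adj G (vtx (inject₁ i)) (vtx (suc i))
open Path public

record Cycle {m : ℕ} (G : Graph m) : Set where
  field
    clen      : ℕ
    cvtx      : Fin (suc (suc (suc clen))) → Fin m
    cdistinct : Injective _≡_ _≡_ cvtx
    cadjacent : ∀ (i : Fin (suc (suc clen))) → Adj G (cvtx (inject₁ i)) (cvtx (suc i))
    cclose    : Adj G (cvtx (fromℕ (suc (suc clen)))) (cvtx zero)

Connected : ∀ {m} → Graph m → Set
Connected {m} G = ∀ (u v : Fin m) →
  u ≡ v ⊎ Σ (Path G) (λ P → vtx P zero ≡ u × vtx P (fromℕ (suc (len P))) ≡ v)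

Acyclic : ∀ {m} → Graph m → Set
Acyclic G = ¬ Cycle G

IsTree : ∀ {m} → Graph m → Set
IsTree G = Connected G × Acyclic G

EdgeIn : ∀ {m} {G : Graph m} → Path G → Fin m → Fin m → Set
EdgeIn P a b = ∃ λ (i : Fin (suc (len P))) →
  (vtx P (inject₁ i) ≡ a × vtx P (suc i) ≡ b) ⊎
  (vtx P (inject₁ i) ≡ b × vtx P (suc i) ≡ a)

UnionAdj : ∀ {m} {G : Graph m} → Path G → Path G → Fin m → Fin m → Set
UnionAdj P Q a b = EdgeIn P a b ⊎ EdgeIn Q a b

HasDeg≥3 : ∀ {m} {G : Graph m} → Path G → Path G → Set
HasDeg≥3 {m} P Q = ∃ λ (x : Fin m) → ∃ λ (y₁ : Fin m) → ∃ λ (y₂ : Fin m) → ∃ λ (y₃ : Fin m) →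
  (y₁ ≢ y₂ × y₁ ≢ y₃ × y₂ ≢ y₃) ×
  (UnionAdj P Q x y₁ × UnionAdj P Q x y₂ × UnionAdj P Q x y₃)

ShareEdge : ∀ {m} {G : Graph m} → Path G → Path G → Set
ShareEdge {m} P Q = ∃ λ (a : Fin m) → ∃ λ (b : Fin m) → EdgeIn P a b × EdgeIn Q a b

NonSplitting : ∀ {m} {G : Graph m} → Path G → Path G → Set
NonSplitting P Q = ShareEdge P Q × ¬ HasDeg≥3 P Q

-- two paths are the same path (same edge set, hence same subgraph)
SamePath : ∀ {m} {G : Graph m} → Path G → Path G → Set
SamePath P Q = ∀ a b → EdgeIn P a b ⇔ EdgeIn Q a b

CycAdj : (k : ℕ) → Fin k → Fin k → Set
CycAdj k i j =
  suc (toℕ i) ≡ toℕ j ⊎ suc (toℕ j) ≡ toℕ i ⊎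
  (toℕ i ≡ 0 × suc (toℕ j) ≡ k) ⊎ (toℕ j ≡ 0 × suc (toℕ i) ≡ k)

-- G ≅ ENPT(T, 𝒫) where 𝒫 = {P u | u : Fin n} is a set of paths (pairwise
-- distinct), and the target graph has vertex set Fin k with adjacency H.
ENPTIso : ∀ {m} (T : Graph m) (n : ℕ) (P : Fin n → Path T)
          (k : ℕ) (H : Fin k → Fin k → Set) → Set
ENPTIso T n P k H =
  (∀ u v → u ≢ v → ¬ SamePath (P u) (P v)) ×
  Σ (Fin n ⤖ Fin k) (λ σ → ∀ u v → u ≢ v →
     NonSplitting (P u) (P v) ⇔ H (Bijection.to σ u) (Bijection.to σ v))

module Submission where

-- The tree is a spider: a centre c with legs c – xᵢ – yᵢ, and two leaves w₁, w₂ hanging off y₀.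
-- With r ≥ 3 legs take the outer edges Lᵢ = xᵢyᵢ and the bridges Bᵢ = yᵢxᵢcxᵢ₊₁yᵢ₊₁ (indices mod r)
-- in the cyclic order L₀ B₀ L₁ B₁ … L_{r-1} B_{r-1}. A bridge contains the outer edges at its two
-- ends, so it is non-splitting with exactly those two; two bridges are edge-disjoint or share a leg,
-- and then they use three spokes at c and split. This realises C₂ᵣ. Replacing the last bridge by its
-- two overlapping subpaths y_{r-1}x_{r-1}cx₀ and x_{r-1}cx₀y₀ realises C₂ᵣ₊₁. The cycles C₃, C₄, C₅
-- are given by explicit paths whose pairwise relations are checked by evaluation; C₅ needs the
-- second branch vertex y₀.

open import Defs hiding (sym)
open import Data.Nat using (ℕ; zero; suc; _+_; _<_; _≤_; z≤n; s≤s; _≥_)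
open import Data.Nat.Properties
  using ( _≟_; _<?_; ≤-refl; ≤-trans; ≤-pred; <⇒≱; <⇒≢; <⇒≯; n≤1+n; 1+n≢n; m≤n⇒m≤1+n; m≤n⇒m<n∨m≡n
        ; suc-injective)
open import Data.Fin using (Fin; zero; suc; inject₁; fromℕ; toℕ; fromℕ<)
open import Data.Fin.Properties
  using (toℕ-injective; toℕ-fromℕ<; toℕ<n; inject₁-injective; toℕ-inject₁)
  renaming (suc-injective to Fin-suc-injective)
open import Data.Fin.Relation.Unary.Top using (view; ‵fromℕ; ‵inj₁)
open import Data.Product using (Σ; ∃; ∃₂; _×_; _,_; proj₁; proj₂)
open import Data.Sum using (_⊎_; inj₁; inj₂)
open import Data.Empty using (⊥; ⊥-elim)
open import Data.List using (List; []; _∷_; length; lookup; _++_)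
open import Data.List.Relation.Unary.Any using (Any; here; there; any?)
open import Data.List.Relation.Unary.All using (All; []; _∷_; all?)
import Data.List.Relation.Unary.All as All
import Data.Fin.Properties as Fin
open import Data.Fin.Patterns using (0F; 1F; 2F; 3F; 4F)
open import Function.Construct.Identity using (⤖-id)
open import Data.List.Relation.Unary.All.Properties using (¬Any⇒All¬) renaming (++⁺ to All-++⁺)
open import Data.List.Relation.Unary.AllPairs using (AllPairs; []; _∷_; allPairs?)
open import Data.List.Relation.Unary.Linked using (Linked; []; [-]; _∷_; linked?)
open import Data.List.Membership.Propositional using (_∈_; _∉_; find)
open import Data.List.Membership.Propositional.Properties using (∈-++⁻; ∈-++⁺ˡ; ∈-++⁺ʳ; ∈-lookup)
open import Data.List.Relation.Binary.Subset.Propositional using (_⊆_)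
open import Relation.Nullary using (¬_; Dec; yes; no; contradiction)
open import Relation.Nullary.Decidable using (True; toWitness; map′; ¬?; _⊎-dec_; _×-dec_)
open import Relation.Binary.Definitions using (DecidableEquality)
open import Relation.Binary.PropositionalEquality
  using (_≡_; _≢_; refl; sym; trans; cong; subst; subst₂; _≗_)
open import Function using (_∘_)
open import Function.Bundles using (Equivalence; _⇔_; mk⇔)
open import Function.Definitions using (Injective)
import Function.Properties.Equivalence as ⇔

WalkEdge : {A : Set} {n : ℕ} → (Fin (suc (suc n)) → A) → A → A → Set
WalkEdge w a b = ∃ λ i → (w (inject₁ i) ≡ a × w (suc i) ≡ b) ⊎ (w (inject₁ i) ≡ b × w (suc i) ≡ a)

module _ {A : Set} {n : ℕ} {w : Fin (suc (suc n)) → A} where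

  walkEdge-sym : ∀ {a b} → WalkEdge w a b → WalkEdge w b a
  walkEdge-sym (i , inj₁ (p , q)) = i , inj₂ (p , q)
  walkEdge-sym (i , inj₂ (p , q)) = i , inj₁ (p , q)

  walkEdge-map : {B : Set} (f : A → B) → ∀ {a b} → WalkEdge w a b → WalkEdge (f ∘ w) (f a) (f b)
  walkEdge-map f (i , inj₁ (p , q)) = i , inj₁ (cong f p , cong f q)
  walkEdge-map f (i , inj₂ (p , q)) = i , inj₂ (cong f p , cong f q)

  walkEdge-cong : ∀ {w′} → w ≗ w′ → ∀ {a b} → WalkEdge w a b → WalkEdge w′ a b
  walkEdge-cong w≗w′ (i , inj₁ (p , q)) = i , inj₁ (trans (sym (w≗w′ _)) p , trans (sym (w≗w′ _)) q)
  walkEdge-cong w≗w′ (i , inj₂ (p , q)) = i , inj₂ (trans (sym (w≗w′ _)) p , trans (sym (w≗w′ _)) q)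

  module _ (w-inj : Injective _≡_ _≡_ w) where
    private
      Succ Pred : A → A → Set
      Succ a b = ∃ λ i → w (inject₁ i) ≡ a × w (suc i) ≡ b
      Pred a b = ∃ λ i → w (suc i) ≡ a × w (inject₁ i) ≡ b

      orient : ∀ {a b} → WalkEdge w a b → Succ a b ⊎ Pred a b
      orient (i , inj₁ (p , q)) = inj₁ (i , p , q)
      orient (i , inj₂ (p , q)) = inj₂ (i , q , p)

      succ-unique : ∀ {a b b′} → Succ a b → Succ a b′ → b ≡ b′
      succ-unique (i , p , q) (j , p′ , q′) with inject₁-injective (w-inj (trans p (sym p′)))
      ... | refl = trans (sym q) q′

      pred-unique : ∀ {a b b′} → Pred a b → Pred a b′ → b ≡ b′
      pred-unique (i , p , q) (j , p′ , q′) with Fin-suc-injective (w-inj (trans p (sym p′)))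
      ... | refl = trans (sym q) q′

    walk-degree≤2 : ∀ {a b₁ b₂ b₃} → WalkEdge w a b₁ → WalkEdge w a b₂ → WalkEdge w a b₃ →
                    b₁ ≢ b₂ → b₁ ≢ b₃ → b₂ ≢ b₃ → ⊥
    walk-degree≤2 e₁ e₂ e₃ b₁≢b₂ b₁≢b₃ b₂≢b₃ with orient e₁ | orient e₂ | orient e₃
    ... | inj₁ s₁ | inj₁ s₂ | _       = b₁≢b₂ (succ-unique s₁ s₂)
    ... | inj₂ p₁ | inj₂ p₂ | _       = b₁≢b₂ (pred-unique p₁ p₂)
    ... | inj₁ s₁ | inj₂ _  | inj₁ s₃ = b₁≢b₃ (succ-unique s₁ s₃)
    ... | inj₂ p₁ | inj₁ _  | inj₂ p₃ = b₁≢b₃ (pred-unique p₁ p₃)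
    ... | inj₁ _  | inj₂ p₂ | inj₂ p₃ = b₂≢b₃ (pred-unique p₂ p₃)
    ... | inj₂ _  | inj₁ s₂ | inj₁ s₃ = b₂≢b₃ (succ-unique s₂ s₃)

module _ {m : ℕ} {G : Graph m} {P Q : Path G} where

  nonSplitting-sym : NonSplitting P Q → NonSplitting Q P
  nonSplitting-sym ((a , b , e , f) , ¬branch) =
    (a , b , f , e) , λ (v , y₁ , y₂ , y₃ , ≢s , u₁ , u₂ , u₃) →
      ¬branch (v , y₁ , y₂ , y₃ , ≢s , swap u₁ , swap u₂ , swap u₃)
    where
    swap : {X Y : Set} → X ⊎ Y → Y ⊎ X
    swap (inj₁ x) = inj₂ x
    swap (inj₂ y) = inj₁ y

  samePath-sym : SamePath P Q → SamePath Q P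
  samePath-sym same a b = ⇔.sym (same a b)

  samePath⇒nonSplitting : SamePath P Q → NonSplitting P Q
  samePath⇒nonSplitting same = (_ , _ , first , Equivalence.to (same _ _) first) , ¬branch
    where
    first : EdgeIn P (vtx P (inject₁ zero)) (vtx P (suc zero))
    first = zero , inj₁ (refl , refl)

    inP : ∀ {a b} → UnionAdj P Q a b → EdgeIn P a b
    inP (inj₁ e) = e
    inP (inj₂ e) = Equivalence.from (same _ _) e

    ¬branch : ¬ HasDeg≥3 P Q
    ¬branch (_ , _ , _ , _ , (≢₁₂ , ≢₁₃ , ≢₂₃) , u₁ , u₂ , u₃) =
      walk-degree≤2 (distinct P) (inP u₁) (inP u₂) (inP u₃) ≢₁₂ ≢₁₃ ≢₂₃

final : {A : Set} → A → List A → A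
final a []       = a
final a (b ∷ vs) = final b vs

final-++ : {A : Set} (a : A) (us vs : List A) → final a (us ++ vs) ≡ final (final a us) vs
final-++ a []       vs = refl
final-++ a (b ∷ us) vs = final-++ b us vs

lookup-final : {A : Set} (a : A) (vs : List A) → lookup (a ∷ vs) (fromℕ (length vs)) ≡ final a vs
lookup-final a []       = refl
lookup-final a (b ∷ vs) = lookup-final b vs

module _ {A : Set} where

  distinct⇒lookup-injective : ∀ {vs : List A} → AllPairs _≢_ vs → Injective _≡_ _≡_ (lookup vs)
  distinct⇒lookup-injective (a≢ ∷ _) {zero} {zero} _ = refl
  distinct⇒lookup-injective (a≢ ∷ _) {zero} {suc j} eq = ⊥-elim (All.lookup a≢ (∈-lookup j) eq)
  distinct⇒lookup-injective d@(_ ∷ _) {suc i} {zero} eq = sym (distinct⇒lookup-injective d (sym eq))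
  distinct⇒lookup-injective (_ ∷ d) {suc i} {suc j} eq = cong suc (distinct⇒lookup-injective d eq)

  module _ {R : A → A → Set} where

    linked-++ : ∀ a us vs → Linked R (a ∷ us) → Linked R (final a us ∷ vs) → Linked R (a ∷ us ++ vs)
    linked-++ a []       vs _          l = l
    linked-++ a (b ∷ us) vs (ab ∷ lus) l = ab ∷ linked-++ b us vs lus l

    linked-lookup : ∀ {a b vs} → Linked R (a ∷ b ∷ vs) →
                    (i : Fin (suc (length vs))) → R (lookup (a ∷ b ∷ vs) (inject₁ i)) (lookup (a ∷ b ∷ vs) (suc i))
    linked-lookup (ab ∷ _) zero = ab
    linked-lookup {vs = _ ∷ _} (_ ∷ l) (suc i) = linked-lookup l i

  module _ (_≟A_ : DecidableEquality A) {R : A → A → Set} {P : A → Set} where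
    open import Data.List.Membership.DecPropositional _≟A_ using (_∈?_)

    private
      suffix : ∀ {a} b vs → a ∈ b ∷ vs → ∃ λ vs′ →
               (Linked R (b ∷ vs) → Linked R (a ∷ vs′)) × (AllPairs _≢_ (b ∷ vs) → AllPairs _≢_ (a ∷ vs′)) ×
               (All P (b ∷ vs) → All P (a ∷ vs′)) × final a vs′ ≡ final b vs
      suffix b vs (here refl) = vs , (λ l → l) , (λ d → d) , (λ p → p) , refl
      suffix b (b′ ∷ vs) (there a∈) with suffix b′ vs a∈
      ... | vs′ , l , d , p , f =
        vs′ , (λ { (_ ∷ l′) → l l′ }) , (λ { (_ ∷ d′) → d d′ }) , (λ { (_ ∷ p′) → p p′ }) , f

    -- Cut out the detour at each repeated vertex.
    shortcut : ∀ a vs → Linked R (a ∷ vs) → All P (a ∷ vs) → ∃ λ vs′ →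
               Linked R (a ∷ vs′) × AllPairs _≢_ (a ∷ vs′) × All P (a ∷ vs′) × final a vs′ ≡ final a vs
    shortcut a [] _ pa = [] , [-] , [] ∷ [] , pa , refl
    shortcut a (b ∷ vs) (ab ∷ l) (pa ∷ ps) with shortcut b vs l ps
    ... | vs′ , l′ , d′ , p′ , f′ with a ∈? b ∷ vs′
    ... | yes a∈ with suffix b vs′ a∈
    ...   | vs″ , l″ , d″ , p″ , f″ = vs″ , l″ l′ , d″ d′ , p″ p′ , trans f″ f′
    shortcut a (b ∷ vs) (ab ∷ l) (pa ∷ ps) | vs′ , l′ , d′ , p′ , f′ | no a∉ =
      b ∷ vs′ , ab ∷ l′ , ¬Any⇒All¬ (b ∷ vs′) a∉ ∷ d′ , pa ∷ p′ , f′

double : ℕ → ℕ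
double zero    = zero
double (suc n) = suc (suc (double n))

double-mono-≤ : ∀ {m n} → m ≤ n → double m ≤ double n
double-mono-≤ z≤n     = z≤n
double-mono-≤ (s≤s p) = s≤s (s≤s (double-mono-≤ p))

double-injective : ∀ {m n} → double m ≡ double n → m ≡ n
double-injective {zero}  {zero}  _  = refl
double-injective {suc m} {suc n} eq = cong suc (double-injective (suc-injective (suc-injective eq)))

double≢suc-double : ∀ m n → double m ≢ suc (double n)
double≢suc-double zero    _       ()
double≢suc-double (suc m) zero    ()
double≢suc-double (suc m) (suc n) eq = double≢suc-double m n (suc-injective (suc-injective eq))

n≢2+n : ∀ (n : ℕ) → n ≢ suc (suc n)
n≢2+n zero    ()
n≢2+n (suc n) eq = n≢2+n n (suc-injective eq)

double-cancel-≤ : ∀ {m n} → double m ≤ suc (double n) → m ≤ n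
double-cancel-≤ {zero}          _                = z≤n
double-cancel-≤ {suc m} {zero}  (s≤s ())
double-cancel-≤ {suc m} {suc n} (s≤s (s≤s m≤n)) = s≤s (double-cancel-≤ m≤n)

data Parity : ℕ → Set where
  even : ∀ i → Parity (double i)
  odd  : ∀ i → Parity (suc (double i))

parity : ∀ t → Parity t
parity zero          = even 0
parity (suc zero)    = odd 0
parity (suc (suc t)) with parity t
... | even i = even (suc i)
... | odd i  = odd (suc i)

Consecutive : ℕ → ℕ → ℕ → Set
Consecutive k t₁ t₂ = suc t₁ ≡ t₂ ⊎ suc t₂ ≡ t₁ ⊎ (t₁ ≡ 0 × suc t₂ ≡ k) ⊎ (t₂ ≡ 0 × suc t₁ ≡ k)

consecutive-sym : ∀ {k t₁ t₂} → Consecutive k t₁ t₂ → Consecutive k t₂ t₁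
consecutive-sym (inj₁ e)               = inj₂ (inj₁ e)
consecutive-sym (inj₂ (inj₁ e))        = inj₁ e
consecutive-sym (inj₂ (inj₂ (inj₁ e))) = inj₂ (inj₂ (inj₂ e))
consecutive-sym (inj₂ (inj₂ (inj₂ e))) = inj₂ (inj₂ (inj₁ e))

consecutive-even-even : ∀ {k i j} → Consecutive k (double i) (double j) →
                        (i ≡ 0 × suc (double j) ≡ k) ⊎ (j ≡ 0 × suc (double i) ≡ k)
consecutive-even-even {i = i} {j} (inj₁ eq)        = ⊥-elim (double≢suc-double j i (sym eq))
consecutive-even-even {i = i} {j} (inj₂ (inj₁ eq)) = ⊥-elim (double≢suc-double i j (sym eq))
consecutive-even-even {i = i} (inj₂ (inj₂ (inj₁ (eq , end)))) = inj₁ (double-injective {i} {0} eq , end)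
consecutive-even-even {j = j} (inj₂ (inj₂ (inj₂ (eq , end)))) = inj₂ (double-injective {j} {0} eq , end)

consecutive-even-odd : ∀ {k i a} → Consecutive k (double i) (suc (double a)) →
                       i ≡ a ⊎ i ≡ suc a ⊎ (i ≡ 0 × double (suc a) ≡ k)
consecutive-even-odd (inj₁ eq) = inj₁ (double-injective (suc-injective eq))
consecutive-even-odd {a = a} (inj₂ (inj₁ eq)) = inj₂ (inj₁ (sym (double-injective {suc a} eq)))
consecutive-even-odd {i = i} (inj₂ (inj₂ (inj₁ (eq , end)))) = inj₂ (inj₂ (double-injective {i} {0} eq , end))
consecutive-even-odd (inj₂ (inj₂ (inj₂ (() , _))))

consecutive-odd-odd : ∀ {k a b} → ¬ Consecutive k (suc (double a)) (suc (double b))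
consecutive-odd-odd {a = a} {b} (inj₁ eq)        = double≢suc-double b a (sym (suc-injective eq))
consecutive-odd-odd {a = a} {b} (inj₂ (inj₁ eq)) = double≢suc-double a b (sym (suc-injective eq))
consecutive-odd-odd (inj₂ (inj₂ (inj₁ (() , _))))
consecutive-odd-odd (inj₂ (inj₂ (inj₂ (() , _))))

consecutive? : ∀ k t₁ t₂ → Dec (Consecutive k t₁ t₂)
consecutive? k t₁ t₂ =
  suc t₁ ≟ t₂ ⊎-dec suc t₂ ≟ t₁ ⊎-dec (t₁ ≟ 0 ×-dec suc t₂ ≟ k) ⊎-dec (t₂ ≟ 0 ×-dec suc t₁ ≟ k)

data V : Set where
  c w₁ w₂ : V
  x y : ℕ → V

data Edge : Set where
  spoke outer : ℕ → Edge
  pendant₁ pendant₂ : Edge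

lower upper : Edge → V
lower (spoke n) = c
lower (outer n) = x n
lower pendant₁  = y 0
lower pendant₂  = y 0
upper (spoke n) = x n
upper (outer n) = y n
upper pendant₁  = w₁
upper pendant₂  = w₂

-- At the centre, which has no edge towards the centre, this is a junk value.
edgeBelow : V → Edge
edgeBelow c     = pendant₁
edgeBelow w₁    = pendant₁
edgeBelow w₂    = pendant₂
edgeBelow (x n) = spoke n
edgeBelow (y n) = outer n

edgeBelow-upper : ∀ e → edgeBelow (upper e) ≡ e
edgeBelow-upper (spoke n) = refl
edgeBelow-upper (outer n) = refl
edgeBelow-upper pendant₁  = refl
edgeBelow-upper pendant₂  = refl

upper-injective : Injective _≡_ _≡_ upper
upper-injective {e} {e′} eq = trans (sym (edgeBelow-upper e)) (trans (cong edgeBelow eq) (edgeBelow-upper e′))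

depth : V → ℕ
depth c     = 0
depth (x n) = 1
depth (y n) = 2
depth w₁    = 3
depth w₂    = 3

depth<4 : ∀ v → depth v < 4
depth<4 c     = s≤s z≤n
depth<4 (x n) = s≤s (s≤s z≤n)
depth<4 (y n) = s≤s (s≤s (s≤s z≤n))
depth<4 w₁    = ≤-refl
depth<4 w₂    = ≤-refl

depth-lower<upper : ∀ e → depth (lower e) < depth (upper e)
depth-lower<upper (spoke n) = ≤-refl
depth-lower<upper (outer n) = ≤-refl
depth-lower<upper pendant₁  = ≤-refl
depth-lower<upper pendant₂  = ≤-refl

Joins : Edge → V → V → Set
Joins e a b = (a ≡ lower e × b ≡ upper e) ⊎ (a ≡ upper e × b ≡ lower e)

Adjacent : V → V → Set
Adjacent a b = ∃ λ e → Joins e a b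

joins-sym : ∀ {e a b} → Joins e a b → Joins e b a
joins-sym (inj₁ (p , q)) = inj₂ (q , p)
joins-sym (inj₂ (p , q)) = inj₁ (q , p)

adjacent-sym : ∀ {a b} → Adjacent a b → Adjacent b a
adjacent-sym (e , j) = e , joins-sym j

adjacent-irrefl : ∀ {a} → ¬ Adjacent a a
adjacent-irrefl (e , inj₁ (p , q)) = <⇒≢ (depth-lower<upper e) (cong depth (trans (sym p) q))
adjacent-irrefl (e , inj₂ (p , q)) = <⇒≢ (depth-lower<upper e) (cong depth (trans (sym q) p))

up : ∀ e → Adjacent (upper e) (lower e)
up   e = e , inj₂ (refl , refl)

down : ∀ e → Adjacent (lower e) (upper e)
down e = e , inj₁ (refl , refl)

private
  deeper : ∀ {e a b} → a ≡ lower e → b ≡ upper e → depth a < depth b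
  deeper {e} refl refl = depth-lower<upper e

joins-unique : ∀ {e e′ a b} → Joins e a b → Joins e′ a b → e ≡ e′
joins-unique (inj₁ (_ , q)) (inj₁ (_ , q′)) = upper-injective (trans (sym q) q′)
joins-unique (inj₂ (p , _)) (inj₂ (p′ , _)) = upper-injective (trans (sym p) p′)
joins-unique (inj₁ (p , q)) (inj₂ (p′ , q′)) = contradiction (deeper p q) (<⇒≯ (deeper q′ p′))
joins-unique (inj₂ (p , q)) (inj₁ (p′ , q′)) = contradiction (deeper p′ q′) (<⇒≯ (deeper q p))

-- Of two distinct neighbours at most one is the parent, so the other lies deeper.
deeper-neighbour : ∀ {e₁ e₂ a b₁ b₂} → Joins e₁ a b₁ → Joins e₂ a b₂ → b₁ ≢ b₂ →
                   depth a < depth b₁ ⊎ depth a < depth b₂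
deeper-neighbour (inj₁ (p , q)) _ _ = inj₁ (deeper p q)
deeper-neighbour (inj₂ _) (inj₁ (p , q)) _ = inj₂ (deeper p q)
deeper-neighbour (inj₂ (p₁ , q₁)) (inj₂ (p₂ , q₂)) b₁≢b₂ =
  ⊥-elim (b₁≢b₂ (trans q₁ (trans (cong lower (upper-injective (trans (sym p₁) p₂))) (sym q₂))))

edgeBetween : V → V → Edge
edgeBetween a b with depth a <? depth b
... | yes _ = edgeBelow b
... | no _  = edgeBelow a

joins⇒edgeBetween : ∀ {e a b} → Joins e a b → edgeBetween a b ≡ e
joins⇒edgeBetween {e} (inj₁ (refl , refl)) with depth (lower e) <? depth (upper e)
... | yes _  = edgeBelow-upper e
... | no ¬lt = contradiction (depth-lower<upper e) ¬lt
joins⇒edgeBetween {e} (inj₂ (refl , refl)) with depth (upper e) <? depth (lower e)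
... | yes lt = contradiction lt (<⇒≯ (depth-lower<upper e))
... | no _   = edgeBelow-upper e

joins-edgeBetween : ∀ {e a b} → Joins e a b → Joins (edgeBetween a b) a b
joins-edgeBetween {a = a} {b} j = subst (λ e → Joins e a b) (sym (joins⇒edgeBetween j)) j

code : V → ℕ
code c     = 0
code w₁    = 1
code w₂    = 2
code (x n) = 3 + double n
code (y n) = 4 + double n

private
  legVertex : ℕ → V
  legVertex zero          = x 0
  legVertex (suc zero)    = y 0
  legVertex (suc (suc p)) with legVertex p
  ... | x n = x (suc n)
  ... | y n = y (suc n)
  ... | v   = v

decode : ℕ → V
decode 0               = c
decode 1               = w₁
decode 2               = w₂
decode (suc (suc (suc p))) = legVertex p

decode-code : ∀ v → decode (code v) ≡ v
decode-code c     = refl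
decode-code w₁    = refl
decode-code w₂    = refl
decode-code (x n) = legVertex-x n
  where
  legVertex-x : ∀ n → legVertex (double n) ≡ x n
  legVertex-x zero = refl
  legVertex-x (suc n) rewrite legVertex-x n = refl
decode-code (y n) = legVertex-y n
  where
  legVertex-y : ∀ n → legVertex (suc (double n)) ≡ y n
  legVertex-y zero = refl
  legVertex-y (suc n) rewrite legVertex-y n = refl

code-decode : ∀ n → code (decode n) ≡ n
code-decode 0 = refl
code-decode 1 = refl
code-decode 2 = refl
code-decode (suc (suc (suc p))) = code-legVertex p
  where
  code-legVertex : ∀ p → code (legVertex p) ≡ 3 + p
  code-legVertex zero          = refl
  code-legVertex (suc zero)    = refl
  code-legVertex (suc (suc p)) with legVertex p | code-legVertex p
  ... | x n | eq = cong (2 +_) eq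
  ... | y n | eq = cong (2 +_) eq
  ... | c   | ()
  ... | w₁  | ()
  ... | w₂  | ()

code-injective : Injective _≡_ _≡_ code
code-injective {u} {v} eq = trans (sym (decode-code u)) (trans (cong decode eq) (decode-code v))

_≟V_ : DecidableEquality V
u ≟V v = map′ code-injective (cong code) (code u ≟ code v)

joins? : ∀ e a b → Dec (Joins e a b)
joins? e a b = (a ≟V lower e ×-dec b ≟V upper e) ⊎-dec (a ≟V upper e ×-dec b ≟V lower e)

adjacent? : ∀ a b → Dec (Adjacent a b)
adjacent? a b = map′ (λ j → _ , j) (λ (_ , j) → joins-edgeBetween j) (joins? (edgeBetween a b) a b)

_≟E_ : DecidableEquality Edge
e ≟E e′ = map′ upper-injective (cong upper) (upper e ≟V upper e′)

Touches : Edge → V → Set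
Touches e a = a ≡ lower e ⊎ a ≡ upper e

touches⇒joins : ∀ {e a} → Touches e a → ∃ λ b → Joins e a b
touches⇒joins (inj₁ refl) = _ , inj₁ (refl , refl)
touches⇒joins (inj₂ refl) = _ , inj₂ (refl , refl)

Fork : Edge → Edge → Edge → Set
Fork e₁ e₂ e₃ = (e₁ ≢ e₂ × e₁ ≢ e₃ × e₂ ≢ e₃) × ∃ λ a → Touches e₁ a × Touches e₂ a × Touches e₃ a

spoke-fork : ∀ {i j l} → i ≢ j → i ≢ l → j ≢ l → Fork (spoke i) (spoke j) (spoke l)
spoke-fork i≢j i≢l j≢l =
  ((λ { refl → i≢j refl }) , (λ { refl → i≢l refl }) , (λ { refl → j≢l refl })) , c , inj₁ refl , inj₁ refl , inj₁ refl

touches? : ∀ e a → Dec (Touches e a)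
touches? e a = a ≟V lower e ⊎-dec a ≟V upper e

fork? : ∀ e₁ e₂ e₃ → Dec (Fork e₁ e₂ e₃)
fork? e₁ e₂ e₃ = (¬? (e₁ ≟E e₂) ×-dec ¬? (e₁ ≟E e₃) ×-dec ¬? (e₂ ≟E e₃)) ×-dec
                 map′ meet meet⁻¹ (at (lower e₁) ⊎-dec at (upper e₁))
  where
  at : ∀ a → Dec (Touches e₂ a × Touches e₃ a)
  at a = touches? e₂ a ×-dec touches? e₃ a

  meet : (Touches e₂ (lower e₁) × Touches e₃ (lower e₁)) ⊎ (Touches e₂ (upper e₁) × Touches e₃ (upper e₁)) →
         ∃ λ a → Touches e₁ a × Touches e₂ a × Touches e₃ a
  meet (inj₁ (t₂ , t₃)) = _ , inj₁ refl , t₂ , t₃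
  meet (inj₂ (t₂ , t₃)) = _ , inj₂ refl , t₂ , t₃

  meet⁻¹ : (∃ λ a → Touches e₁ a × Touches e₂ a × Touches e₃ a) →
           (Touches e₂ (lower e₁) × Touches e₃ (lower e₁)) ⊎ (Touches e₂ (upper e₁) × Touches e₃ (upper e₁))
  meet⁻¹ (_ , inj₁ refl , t₂ , t₃) = inj₁ (t₂ , t₃)
  meet⁻¹ (_ , inj₂ refl , t₂ , t₃) = inj₂ (t₂ , t₃)

joins⇒walkEdge : ∀ {B : Set} {n} {w : Fin (suc (suc n)) → B} (f : V → B) {e a b} →
                 WalkEdge w (f (lower e)) (f (upper e)) → Joins e a b → WalkEdge w (f a) (f b)
joins⇒walkEdge f we (inj₁ (refl , refl)) = we
joins⇒walkEdge {w = w} f we (inj₂ (refl , refl)) = walkEdge-sym {w = w} we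

edgesAlong : List V → List Edge
edgesAlong []           = []
edgesAlong (_ ∷ [])     = []
edgesAlong (a ∷ b ∷ vs) = edgeBetween a b ∷ edgesAlong (b ∷ vs)

along⇒walkEdge : ∀ {a b vs} → Linked Adjacent (a ∷ b ∷ vs) → ∀ {e} → e ∈ edgesAlong (a ∷ b ∷ vs) →
                 WalkEdge (lookup (a ∷ b ∷ vs)) (lower e) (upper e)
along⇒walkEdge ((_ , j) ∷ _) (here refl) = zero , joins-edgeBetween j
along⇒walkEdge (_ ∷ l@(_ ∷ _)) (there e∈) with along⇒walkEdge l e∈
... | i , pr = suc i , pr

walkEdge⇒along : ∀ {a b vs} → Linked Adjacent (a ∷ b ∷ vs) → ∀ {u v} → WalkEdge (lookup (a ∷ b ∷ vs)) u v →
                 ∃ λ e → e ∈ edgesAlong (a ∷ b ∷ vs) × Joins e u v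
walkEdge⇒along ((_ , j) ∷ _) (zero , inj₁ (refl , refl)) = _ , here refl , joins-edgeBetween j
walkEdge⇒along ((_ , j) ∷ _) (zero , inj₂ (refl , refl)) = _ , here refl , joins-sym (joins-edgeBetween j)
walkEdge⇒along {vs = _ ∷ _} (_ ∷ l) (suc i , pr) with walkEdge⇒along l (i , pr)
... | e , e∈ , j = e , there e∈ , j

-- The pendant edges lie on no leg; they get the junk value 0.
leg : Edge → ℕ
leg (spoke n) = n
leg (outer n) = n
leg pendant₁  = 0
leg pendant₂  = 0

module Spider (r : ℕ) where

  m : ℕ
  m = 3 + double r

  InRange : V → Set
  InRange v = code v < m

  centre-inRange : InRange c
  centre-inRange = s≤s z≤n

  x-inRange : ∀ {n} → n < r → InRange (x n)
  x-inRange n<r = s≤s (s≤s (s≤s (≤-trans (n≤1+n _) (double-mono-≤ n<r))))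

  y-inRange : ∀ {n} → n < r → InRange (y n)
  y-inRange n<r = s≤s (s≤s (s≤s (double-mono-≤ n<r)))

  vertex : Fin m → V
  vertex a = decode (toℕ a)

  index : V → Fin m
  index v with code v <? m
  ... | yes p = fromℕ< p
  ... | no _  = zero

  vertex-index : ∀ {v} → InRange v → vertex (index v) ≡ v
  vertex-index {v} inR with code v <? m
  ... | yes p = trans (cong decode (toℕ-fromℕ< p)) (decode-code v)
  ... | no ¬p = contradiction inR ¬p

  vertex-inRange : ∀ a → InRange (vertex a)
  vertex-inRange a = subst (_< m) (sym (code-decode (toℕ a))) (toℕ<n a)

  vertex-injective : Injective _≡_ _≡_ vertex
  vertex-injective eq = toℕ-injective (trans (sym (code-decode _)) (trans (cong code eq) (code-decode _)))

  index-vertex : ∀ a → index (vertex a) ≡ a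
  index-vertex a = vertex-injective (vertex-index (vertex-inRange a))

  T : Graph m
  T = record { Adj = λ a b → Adjacent (vertex a) (vertex b) ; sym = adjacent-sym ; irrefl = adjacent-irrefl }

  open Cycle

  cycle-neighbours : (C : Cycle T) → ∀ p → ∃₂ λ q₁ q₂ → q₁ ≢ q₂ ×
                     Adj T (cvtx C p) (cvtx C q₁) × Adj T (cvtx C p) (cvtx C q₂)
  cycle-neighbours C p with view p
  ... | ‵fromℕ = zero , inject₁ (fromℕ _) , (λ ()) , cclose C , adjacent-sym (cadjacent C (fromℕ _))
  ... | ‵inj₁ {i = zero} _ = suc zero , fromℕ _ , (λ ()) , cadjacent C zero , adjacent-sym (cclose C)
  ... | ‵inj₁ {i = suc j} _ =
    suc (suc j) , inject₁ (inject₁ j) ,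
    (λ eq → n≢2+n (toℕ j) (sym (trans (cong toℕ eq) (trans (toℕ-inject₁ _) (toℕ-inject₁ j))))) ,
    cadjacent C (suc j) , adjacent-sym (cadjacent C (inject₁ j))

  -- Every vertex of a cycle has a deeper neighbour on it, but depths are bounded.
  cycle-climbs : (C : Cycle T) → ∀ n → ∃ λ p → n ≤ depth (vertex (cvtx C p))
  cycle-climbs C zero = zero , z≤n
  cycle-climbs C (suc n) with cycle-climbs C n
  ... | p , n≤ with cycle-neighbours C p
  ... | q₁ , q₂ , q₁≢q₂ , (_ , j₁) , (_ , j₂)
    with deeper-neighbour j₁ j₂ (q₁≢q₂ ∘ cdistinct C ∘ vertex-injective)
  ...   | inj₁ lt = q₁ , ≤-trans (s≤s n≤) lt
  ...   | inj₂ lt = q₂ , ≤-trans (s≤s n≤) lt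

  acyclic : Acyclic T
  acyclic C = let p , 4≤p = cycle-climbs C 4 in <⇒≱ (depth<4 (vertex (cvtx C p))) 4≤p

  record ListPath : Set where
    constructor listPath
    field
      v₀ v₁ : V
      vs : List V

    vertices : List V
    vertices = v₀ ∷ v₁ ∷ vs

    field
      linked  : Linked Adjacent vertices
      unique  : AllPairs _≢_ vertices
      inRange : All InRange vertices

    edges : List Edge
    edges = edgesAlong vertices

  open ListPath public

  inRangeAt : ∀ p i → InRange (lookup (vertices p) i)
  inRangeAt p i = All.lookup (inRange p) (∈-lookup i)

  toPath : ListPath → Path T
  toPath p = record
    { len      = length (vs p)
    ; vtx      = index ∘ lookup (vertices p)
    ; distinct = λ {i} {j} eq → distinct⇒lookup-injective (unique p) (index-injective {i} {j} eq)
    ; adjacent = λ i → subst₂ Adjacent (sym (vertex-index (inRangeAt p (inject₁ i)))) (sym (vertex-index (inRangeAt p (suc i))))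
                                      (linked-lookup (linked p) i)
    }
    where
    index-injective : ∀ {i j} → index (lookup (vertices p) i) ≡ index (lookup (vertices p) j) →
                      lookup (vertices p) i ≡ lookup (vertices p) j
    index-injective {i} {j} eq = trans (sym (vertex-index (inRangeAt p i))) (trans (cong vertex eq) (vertex-index (inRangeAt p j)))

  module _ (p : ListPath) where

    walkEdge-inRange : ∀ {a b} → WalkEdge (lookup (vertices p)) a b → InRange a × InRange b
    walkEdge-inRange (i , inj₁ (refl , refl)) = inRangeAt p (inject₁ i) , inRangeAt p (suc i)
    walkEdge-inRange (i , inj₂ (refl , refl)) = inRangeAt p (suc i) , inRangeAt p (inject₁ i)

    edge-inRange : ∀ {e} → e ∈ edges p → InRange (lower e) × InRange (upper e)
    edge-inRange = walkEdge-inRange ∘ along⇒walkEdge (linked p)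

    edge⇒edgeIn : ∀ {e} → e ∈ edges p → EdgeIn (toPath p) (index (lower e)) (index (upper e))
    edge⇒edgeIn e∈ = walkEdge-map {w = lookup (vertices p)} index (along⇒walkEdge (linked p) e∈)

    edgeIn⇒edge : ∀ {a b} → EdgeIn (toPath p) a b → ∃ λ e → e ∈ edges p × Joins e (vertex a) (vertex b)
    edgeIn⇒edge e = walkEdge⇒along (linked p)
      (walkEdge-cong {w = vertex ∘ index ∘ lookup (vertices p)} {w′ = lookup (vertices p)} (vertex-index ∘ inRangeAt p)
                     (walkEdge-map {w = index ∘ lookup (vertices p)} vertex e))

    joins-edge : ∀ {e} → e ∈ edges p → Joins e (vertex (index (lower e))) (vertex (index (upper e)))
    joins-edge e∈ = inj₁ (vertex-index (proj₁ (edge-inRange e∈)) , vertex-index (proj₂ (edge-inRange e∈)))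

  joins-inRange : ∀ {e a b} → Joins e a b → InRange (lower e) × InRange (upper e) → InRange b
  joins-inRange (inj₁ (_ , refl)) (_ , r) = r
  joins-inRange (inj₂ (_ , refl)) (r , _) = r

  Union : ListPath → ListPath → List Edge
  Union p q = edges p ++ edges q

  module _ (p q : ListPath) where

    common⇒shareEdge : ∀ {e} → e ∈ edges p → e ∈ edges q → ShareEdge (toPath p) (toPath q)
    common⇒shareEdge e∈p e∈q = _ , _ , edge⇒edgeIn p e∈p , edge⇒edgeIn q e∈q

    shareEdge⇒common : ShareEdge (toPath p) (toPath q) → ∃ λ e → e ∈ edges p × e ∈ edges q
    shareEdge⇒common (_ , _ , in-p , in-q) with edgeIn⇒edge p in-p | edgeIn⇒edge q in-q
    ... | e , e∈p , j | e′ , e′∈q , j′ = e , e∈p , subst (_∈ edges q) (joins-unique j′ j) e′∈q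

    ¬nonSplitting-if-disjoint : (∀ {e} → e ∈ edges p → e ∉ edges q) → ¬ NonSplitting (toPath p) (toPath q)
    ¬nonSplitting-if-disjoint disjoint (share , _) with shareEdge⇒common share
    ... | _ , e∈p , e∈q = disjoint e∈p e∈q

    -- P ∪ Q lies in W, where no vertex has degree 3.
    nonSplitting-within : (W : ListPath) → edges p ⊆ edges W → edges q ⊆ edges W →
                          ∀ {e} → e ∈ edges p → e ∈ edges q → NonSplitting (toPath p) (toPath q)
    nonSplitting-within W p⊆W q⊆W e∈p e∈q = common⇒shareEdge e∈p e∈q , ¬branching
      where
      inW : ∀ {a b} → UnionAdj (toPath p) (toPath q) a b → WalkEdge (lookup (vertices W)) (vertex a) (vertex b)
      inW (inj₁ in-p) with edgeIn⇒edge p in-p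
      ... | e , e∈ , j = joins⇒walkEdge {w = lookup (vertices W)} (λ v → v) (along⇒walkEdge (linked W) (p⊆W e∈)) j
      inW (inj₂ in-q) with edgeIn⇒edge q in-q
      ... | e , e∈ , j = joins⇒walkEdge {w = lookup (vertices W)} (λ v → v) (along⇒walkEdge (linked W) (q⊆W e∈)) j

      ¬branching : ¬ HasDeg≥3 (toPath p) (toPath q)
      ¬branching (_ , _ , _ , _ , (≢₁₂ , ≢₁₃ , ≢₂₃) , u₁ , u₂ , u₃) =
        walk-degree≤2 (distinct⇒lookup-injective (unique W)) (inW u₁) (inW u₂) (inW u₃)
          (≢₁₂ ∘ vertex-injective) (≢₁₃ ∘ vertex-injective) (≢₂₃ ∘ vertex-injective)

    ¬nonSplitting-if-fork : ∀ {e₁ e₂ e₃} → e₁ ∈ Union p q → e₂ ∈ Union p q → e₃ ∈ Union p q →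
                            Fork e₁ e₂ e₃ → ¬ NonSplitting (toPath p) (toPath q)
    ¬nonSplitting-if-fork e₁∈ e₂∈ e₃∈ ((≢₁₂ , ≢₁₃ , ≢₂₃) , a , t₁ , t₂ , t₃) (_ , ¬branch)
      with touches⇒joins t₁ | touches⇒joins t₂ | touches⇒joins t₃
    ... | b₁ , j₁ | b₂ , j₂ | b₃ , j₃ =
      ¬branch (index a , index b₁ , index b₂ , index b₃ ,
               ( far-distinct e₁∈ e₂∈ j₁ j₂ ≢₁₂
               , far-distinct e₁∈ e₃∈ j₁ j₃ ≢₁₃
               , far-distinct e₂∈ e₃∈ j₂ j₃ ≢₂₃) ,
               union e₁∈ j₁ , union e₂∈ j₂ , union e₃∈ j₃)
      where
      union : ∀ {e a b} → e ∈ Union p q → Joins e a b → UnionAdj (toPath p) (toPath q) (index a) (index b)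
      union e∈ j with ∈-++⁻ (edges p) e∈
      ... | inj₁ e∈p = inj₁ (joins⇒walkEdge {w = vtx (toPath p)} index (edge⇒edgeIn p e∈p) j)
      ... | inj₂ e∈q = inj₂ (joins⇒walkEdge {w = vtx (toPath q)} index (edge⇒edgeIn q e∈q) j)

      far : ∀ {e a b} → e ∈ Union p q → Joins e a b → InRange b
      far e∈ j with ∈-++⁻ (edges p) e∈
      ... | inj₁ e∈p = joins-inRange j (edge-inRange p e∈p)
      ... | inj₂ e∈q = joins-inRange j (edge-inRange q e∈q)

      far-distinct : ∀ {e e′ a b b′} → e ∈ Union p q → e′ ∈ Union p q → Joins e a b → Joins e′ a b′ →
                     e ≢ e′ → index b ≢ index b′
      far-distinct {e′ = e′} {a} {b} {b′} e∈ e′∈ j j′ e≢e′ eq =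
        e≢e′ (joins-unique j (subst (Joins e′ a) (sym b≡b′) j′))
        where
        b≡b′ : b ≡ b′
        b≡b′ = trans (sym (vertex-index (far e∈ j))) (trans (cong vertex eq) (vertex-index (far e′∈ j′)))

    ¬samePath-if-missing : ∀ {e} → e ∈ edges p → e ∉ edges q → ¬ SamePath (toPath p) (toPath q)
    ¬samePath-if-missing e∈p e∉q same with edgeIn⇒edge q (Equivalence.to (same _ _) (edge⇒edgeIn p e∈p))
    ... | e′ , e′∈q , j = e∉q (subst (_∈ edges q) (joins-unique j (joins-edge p e∈p)) e′∈q)

  towardsCentre fromCentre : V → List V
  towardsCentre c     = []
  towardsCentre (x n) = c ∷ []
  towardsCentre (y n) = x n ∷ c ∷ []
  towardsCentre w₁    = y 0 ∷ x 0 ∷ c ∷ []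
  towardsCentre w₂    = y 0 ∷ x 0 ∷ c ∷ []
  fromCentre c     = []
  fromCentre (x n) = x n ∷ []
  fromCentre (y n) = x n ∷ y n ∷ []
  fromCentre w₁    = x 0 ∷ y 0 ∷ w₁ ∷ []
  fromCentre w₂    = x 0 ∷ y 0 ∷ w₂ ∷ []

  final-towardsCentre : ∀ v → final v (towardsCentre v) ≡ c
  final-towardsCentre c     = refl
  final-towardsCentre (x n) = refl
  final-towardsCentre (y n) = refl
  final-towardsCentre w₁    = refl
  final-towardsCentre w₂    = refl

  final-fromCentre : ∀ v → final c (fromCentre v) ≡ v
  final-fromCentre c     = refl
  final-fromCentre (x n) = refl
  final-fromCentre (y n) = refl
  final-fromCentre w₁    = refl
  final-fromCentre w₂    = refl

  linked-towardsCentre : ∀ v → Linked Adjacent (v ∷ towardsCentre v)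
  linked-towardsCentre c     = [-]
  linked-towardsCentre (x n) = up (spoke n) ∷ [-]
  linked-towardsCentre (y n) = up (outer n) ∷ up (spoke n) ∷ [-]
  linked-towardsCentre w₁    = up pendant₁ ∷ up (outer 0) ∷ up (spoke 0) ∷ [-]
  linked-towardsCentre w₂    = up pendant₂ ∷ up (outer 0) ∷ up (spoke 0) ∷ [-]

  linked-fromCentre : ∀ v → Linked Adjacent (c ∷ fromCentre v)
  linked-fromCentre c     = [-]
  linked-fromCentre (x n) = down (spoke n) ∷ [-]
  linked-fromCentre (y n) = down (spoke n) ∷ down (outer n) ∷ [-]
  linked-fromCentre w₁    = down (spoke 0) ∷ down (outer 0) ∷ down pendant₁ ∷ [-]
  linked-fromCentre w₂    = down (spoke 0) ∷ down (outer 0) ∷ down pendant₂ ∷ [-]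

  walkVia : V → V → List V
  walkVia u v = towardsCentre u ++ fromCentre v

  linked-walkVia : ∀ u v → Linked Adjacent (u ∷ walkVia u v)
  linked-walkVia u v = linked-++ u (towardsCentre u) (fromCentre v) (linked-towardsCentre u)
    (subst (λ z → Linked Adjacent (z ∷ fromCentre v)) (sym (final-towardsCentre u)) (linked-fromCentre v))

  final-walkVia : ∀ u v → final u (walkVia u v) ≡ v
  final-walkVia u v = trans (final-++ u (towardsCentre u) (fromCentre v))
                            (trans (cong (λ z → final z (fromCentre v)) (final-towardsCentre u)) (final-fromCentre v))

  module _ (r≥1 : 1 ≤ r) where

    towardsCentre-inRange : ∀ {v} → InRange v → All InRange (v ∷ towardsCentre v)
    towardsCentre-inRange {c}   rc = rc ∷ []
    towardsCentre-inRange {x n} rx = rx ∷ centre-inRange ∷ []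
    towardsCentre-inRange {y n} ry = ry ∷ ≤-trans (n≤1+n _) ry ∷ centre-inRange ∷ []
    towardsCentre-inRange {w₁}  rw = rw ∷ y-inRange r≥1 ∷ x-inRange r≥1 ∷ centre-inRange ∷ []
    towardsCentre-inRange {w₂}  rw = rw ∷ y-inRange r≥1 ∷ x-inRange r≥1 ∷ centre-inRange ∷ []

    fromCentre-inRange : ∀ {v} → InRange v → All InRange (fromCentre v)
    fromCentre-inRange {c}   _  = []
    fromCentre-inRange {x n} rx = rx ∷ []
    fromCentre-inRange {y n} ry = ≤-trans (n≤1+n _) ry ∷ ry ∷ []
    fromCentre-inRange {w₁}  rw = x-inRange r≥1 ∷ y-inRange r≥1 ∷ rw ∷ []
    fromCentre-inRange {w₂}  rw = x-inRange r≥1 ∷ y-inRange r≥1 ∷ rw ∷ []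

    connected : Connected T
    connected u v with shortcut _≟V_ (vertex u) (walkVia (vertex u) (vertex v)) (linked-walkVia _ _)
                         (All-++⁺ (towardsCentre-inRange (vertex-inRange u)) (fromCentre-inRange (vertex-inRange v)))
    ... | [] , _ , _ , _ , end = inj₁ (vertex-injective (trans end (final-walkVia (vertex u) (vertex v))))
    ... | b ∷ vs , l , d , inR , end =
      inj₂ (toPath (listPath (vertex u) b vs l d inR) , index-vertex u ,
            trans (cong index (trans (lookup-final (vertex u) (b ∷ vs)) (trans end (final-walkVia (vertex u) (vertex v)))))
                  (index-vertex v))

    isTree : IsTree T
    isTree = connected , acyclic

  record Realises (p q : ListPath) (k t₁ t₂ : ℕ) : Set where
    field
      nonSplitting⇔consecutive : NonSplitting (toPath p) (toPath q) ⇔ Consecutive k t₁ t₂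
      distinctPaths            : ¬ SamePath (toPath p) (toPath q)

  open Realises public

  module _ {p q : ListPath} {k t₁ t₂ : ℕ} where

    realises-apart : ¬ NonSplitting (toPath p) (toPath q) → ¬ Consecutive k t₁ t₂ → Realises p q k t₁ t₂
    realises-apart ¬ns ¬cons = record
      { nonSplitting⇔consecutive = mk⇔ (⊥-elim ∘ ¬ns) (⊥-elim ∘ ¬cons)
      ; distinctPaths            = λ same → ¬ns (samePath⇒nonSplitting {P = toPath p} {Q = toPath q} same)
      }

    realises-adjacent : NonSplitting (toPath p) (toPath q) → Consecutive k t₁ t₂ →
                        ¬ SamePath (toPath p) (toPath q) → Realises p q k t₁ t₂
    realises-adjacent ns cons ¬same = record
      { nonSplitting⇔consecutive = mk⇔ (λ _ → cons) (λ _ → ns)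
      ; distinctPaths            = ¬same
      }

    realises-sym : Realises p q k t₁ t₂ → Realises q p k t₂ t₁
    realises-sym ℜ = record
      { nonSplitting⇔consecutive =
          mk⇔ (λ ns → consecutive-sym (Equivalence.to ⇔pq (nonSplitting-sym {P = toPath q} {Q = toPath p} ns)))
              (λ cons → nonSplitting-sym {P = toPath p} {Q = toPath q} (Equivalence.from ⇔pq (consecutive-sym cons)))
      ; distinctPaths            = λ same → distinctPaths ℜ (samePath-sym {P = toPath q} {Q = toPath p} same)
      }
      where ⇔pq = nonSplitting⇔consecutive ℜ

  open import Data.List.Membership.DecPropositional _≟E_ using (_∈?_; _∉?_)

  route : (v₀ v₁ : V) (vs : List V) →
          {True (linked? adjacent? (v₀ ∷ v₁ ∷ vs))} →
          {True (allPairs? (λ a b → ¬? (a ≟V b)) (v₀ ∷ v₁ ∷ vs))} →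
          {True (all? (λ v → code v <? m) (v₀ ∷ v₁ ∷ vs))} → ListPath
  route v₀ v₁ vs {l} {u} {i} = listPath v₀ v₁ vs (toWitness l) (toWitness u) (toWitness i)

  -- Sufficient conditions, checkable by evaluation, for a pair of concrete paths to realise
  -- (non-)consecutiveness: lying together in one of the paths Ws, or being edge-disjoint or forking.
  Together : ListPath → ListPath → ListPath → Set
  Together p q W = Any (_∈ edges q) (edges p) × All (_∈ edges W) (edges p) × All (_∈ edges W) (edges q) ×
                   (Any (_∉ edges q) (edges p) ⊎ Any (_∉ edges p) (edges q))

  Apart : ListPath → ListPath → Set
  Apart p q = All (_∉ edges q) (edges p) ⊎ Any (λ e₁ → Any (λ e₂ → Any (Fork e₁ e₂) U) U) U
    where U = Union p q

  Certificate : List ListPath → ListPath → ListPath → ℕ → ℕ → ℕ → Set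
  Certificate Ws p q k t₁ t₂ = (Any (Together p q) Ws × Consecutive k t₁ t₂) ⊎ (Apart p q × ¬ Consecutive k t₁ t₂)

  certificate? : ∀ Ws p q k t₁ t₂ → Dec (Certificate Ws p q k t₁ t₂)
  certificate? Ws p q k t₁ t₂ =
    (any? together? Ws ×-dec consecutive? k t₁ t₂) ⊎-dec (apart? ×-dec ¬? (consecutive? k t₁ t₂))
    where
    together? : ∀ W → Dec (Together p q W)
    together? W = any? (_∈? edges q) (edges p) ×-dec all? (_∈? edges W) (edges p) ×-dec all? (_∈? edges W) (edges q) ×-dec
                  (any? (_∉? edges q) (edges p) ⊎-dec any? (_∉? edges p) (edges q))

    apart? : Dec (Apart p q)
    apart? = all? (_∉? edges q) (edges p) ⊎-dec any? (λ e₁ → any? (λ e₂ → any? (fork? e₁ e₂) U) U) U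
      where U = Union p q

  module _ {p q : ListPath} {k t₁ t₂ : ℕ} where

    differ⇒¬samePath : Any (_∉ edges q) (edges p) ⊎ Any (_∉ edges p) (edges q) → ¬ SamePath (toPath p) (toPath q)
    differ⇒¬samePath (inj₁ d) = let _ , e∈p , e∉q = find d in ¬samePath-if-missing p q e∈p e∉q
    differ⇒¬samePath (inj₂ d) = let _ , e∈q , e∉p = find d in
      λ same → ¬samePath-if-missing q p e∈q e∉p (samePath-sym {P = toPath p} {Q = toPath q} same)

    certificate⇒realises : ∀ {Ws} → Certificate Ws p q k t₁ t₂ → Realises p q k t₁ t₂
    certificate⇒realises (inj₁ (together , cons)) =
      let W , _ , common , p⊆W , q⊆W , differ = find together
          _ , e∈p , e∈q = find common in
      realises-adjacent (nonSplitting-within p q W (All.lookup p⊆W) (All.lookup q⊆W) e∈p e∈q) cons (differ⇒¬samePath differ)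
    certificate⇒realises (inj₂ (inj₁ disjoint , ¬cons)) =
      realises-apart (¬nonSplitting-if-disjoint p q (All.lookup disjoint)) ¬cons
    certificate⇒realises (inj₂ (inj₂ fork , ¬cons)) =
      let _ , e₁∈ , fork₂ = find fork
          _ , e₂∈ , fork₃ = find fork₂
          _ , e₃∈ , F     = find fork₃ in
      realises-apart (¬nonSplitting-if-fork p q e₁∈ e₂∈ e₃∈ F) ¬cons

  certified : ∀ {n} (P : Fin n → ListPath) (Ws : List ListPath) →
              {True (Fin.all? λ u → Fin.all? λ v → u Fin.≟ v ⊎-dec certificate? Ws (P u) (P v) n (toℕ u) (toℕ v))} →
              ∀ u v → u ≢ v → Realises (P u) (P v) n (toℕ u) (toℕ v)
  certified P Ws {ok} u v u≢v with toWitness ok u v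
  ... | inj₁ u≡v  = ⊥-elim (u≢v u≡v)
  ... | inj₂ cert = certificate⇒realises cert

  realises⇒ENPT : ∀ {n} (P : Fin n → ListPath) → (∀ u v → u ≢ v → Realises (P u) (P v) n (toℕ u) (toℕ v)) →
                  ENPTIso T n (toPath ∘ P) n (CycAdj n)
  realises⇒ENPT P ℜ = (λ u v u≢v → distinctPaths (ℜ u v u≢v)) , ⤖-id _ ,
                      (λ u v u≢v → nonSplitting⇔consecutive (ℜ u v u≢v))

module C₃ where
  open Spider 1 public

  paths : Fin 3 → ListPath
  paths 0F = route c (x 0) (y 0 ∷ [])
  paths 1F = route (x 0) (y 0) (w₁ ∷ [])
  paths 2F = route c (x 0) (y 0 ∷ w₁ ∷ [])

  enpt : ENPTIso T 3 (toPath ∘ paths) 3 (CycAdj 3)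
  enpt = realises⇒ENPT paths (certified paths (paths 2F ∷ []))

module C₄ where
  open Spider 1 public

  paths : Fin 4 → ListPath
  paths 0F = route c (x 0) []
  paths 1F = route c (x 0) (y 0 ∷ w₂ ∷ [])
  paths 2F = route (x 0) (y 0) []
  paths 3F = route c (x 0) (y 0 ∷ w₁ ∷ [])

  enpt : ENPTIso T 4 (toPath ∘ paths) 4 (CycAdj 4)
  enpt = realises⇒ENPT paths (certified paths (paths 1F ∷ paths 3F ∷ []))

module C₅ where
  open Spider 3 public

  paths : Fin 5 → ListPath
  paths 0F = route c (x 0) (y 0 ∷ w₂ ∷ [])
  paths 1F = route (x 0) c (x 1 ∷ [])
  paths 2F = route w₁ (y 0) (x 0 ∷ c ∷ x 1 ∷ [])
  paths 3F = route w₁ (y 0) (x 0 ∷ [])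
  paths 4F = route (x 2) c (x 0 ∷ y 0 ∷ [])

  enpt : ENPTIso T 5 (toPath ∘ paths) 5 (CycAdj 5)
  enpt = realises⇒ENPT paths (certified paths
    (route (x 1) c (x 0 ∷ y 0 ∷ w₂ ∷ []) ∷ paths 2F ∷ route w₁ (y 0) (x 0 ∷ c ∷ x 2 ∷ []) ∷
     route (x 2) c (x 0 ∷ y 0 ∷ w₂ ∷ []) ∷ []))

module LongCycle (h : ℕ) where

  q r : ℕ
  q = suc (suc h)
  r = suc q

  open Spider r public

  outerPath : ∀ {i} → i < r → ListPath
  outerPath {i} i<r = listPath (x i) (y i) [] (down (outer i) ∷ [-]) (((λ ()) ∷ []) ∷ [] ∷ [])
                               (x-inRange i<r ∷ y-inRange i<r ∷ [])

  module _ {a b : ℕ} (a<r : a < r) (b<r : b < r) (a≢b : a ≢ b) where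
    private
      x≢x : x a ≢ x b
      x≢x refl = a≢b refl

      y≢y : y a ≢ y b
      y≢y refl = a≢b refl

    bridge bridgeˡ bridgeʳ : ListPath
    bridge = listPath (y a) (x a) (c ∷ x b ∷ y b ∷ [])
      (up (outer a) ∷ up (spoke a) ∷ down (spoke b) ∷ down (outer b) ∷ [-])
      (((λ ()) ∷ (λ ()) ∷ (λ ()) ∷ y≢y ∷ []) ∷ ((λ ()) ∷ x≢x ∷ (λ ()) ∷ []) ∷ ((λ ()) ∷ (λ ()) ∷ []) ∷
       ((λ ()) ∷ []) ∷ [] ∷ [])
      (y-inRange a<r ∷ x-inRange a<r ∷ centre-inRange ∷ x-inRange b<r ∷ y-inRange b<r ∷ [])
    bridgeˡ = listPath (y a) (x a) (c ∷ x b ∷ [])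
      (up (outer a) ∷ up (spoke a) ∷ down (spoke b) ∷ [-])
      (((λ ()) ∷ (λ ()) ∷ (λ ()) ∷ []) ∷ ((λ ()) ∷ x≢x ∷ []) ∷ ((λ ()) ∷ []) ∷ [] ∷ [])
      (y-inRange a<r ∷ x-inRange a<r ∷ centre-inRange ∷ x-inRange b<r ∷ [])
    bridgeʳ = listPath (x a) c (x b ∷ y b ∷ [])
      (up (spoke a) ∷ down (spoke b) ∷ down (outer b) ∷ [-])
      (((λ ()) ∷ x≢x ∷ (λ ()) ∷ []) ∷ ((λ ()) ∷ (λ ()) ∷ []) ∷ ((λ ()) ∷ []) ∷ [] ∷ [])
      (x-inRange a<r ∷ centre-inRange ∷ x-inRange b<r ∷ y-inRange b<r ∷ [])

    outer∈bridge : ∀ {i} → outer i ∈ edges bridge ⇔ (i ≡ a ⊎ i ≡ b)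
    outer∈bridge = mk⇔ (λ { (here refl) → inj₁ refl ; (there (there (there (here refl)))) → inj₂ refl
                          ; (there (here ())) ; (there (there (here ()))) ; (there (there (there (there ())))) })
                       (λ { (inj₁ refl) → here refl ; (inj₂ refl) → there (there (there (here refl))) })

    outer∈bridgeˡ : ∀ {i} → outer i ∈ edges bridgeˡ ⇔ i ≡ a
    outer∈bridgeˡ = mk⇔ (λ { (here refl) → refl ; (there (here ())) ; (there (there (here ()))) ; (there (there (there ()))) })
                        (λ { refl → here refl })

    outer∈bridgeʳ : ∀ {i} → outer i ∈ edges bridgeʳ ⇔ i ≡ b
    outer∈bridgeʳ = mk⇔ (λ { (here ()) ; (there (here ())) ; (there (there (here refl))) → refl ; (there (there (there ()))) })
                        (λ { refl → there (there (here refl)) })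

    leg-bridge : ∀ {e} → e ∈ edges bridge → leg e ≡ a ⊎ leg e ≡ b
    leg-bridge (here refl)                         = inj₁ refl
    leg-bridge (there (here refl))                 = inj₁ refl
    leg-bridge (there (there (here refl)))         = inj₂ refl
    leg-bridge (there (there (there (here refl)))) = inj₂ refl

  -- A shared edge means a shared leg, and then the union uses three spokes at the centre.
  bridge-apart : ∀ {a b a′ b′} (a<r : a < r) (b<r : b < r) (a≢b : a ≢ b)
                 (a′<r : a′ < r) (b′<r : b′ < r) (a′≢b′ : a′ ≢ b′) (p : ListPath) →
                 spoke a′ ∈ edges p → spoke b′ ∈ edges p → edges p ⊆ edges (bridge a′<r b′<r a′≢b′) →
                 ¬ (a ≡ a′ × b ≡ b′) → ¬ (a ≡ b′ × b ≡ a′) →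
                 ¬ NonSplitting (toPath (bridge a<r b<r a≢b)) (toPath p)
  bridge-apart {a} {b} {a′} {b′} a<r b<r a≢b a′<r b′<r a′≢b′ p a′∈ b′∈ p⊆ ≢straight ≢crossed ns =
    let l , l∈ , a≢l , b≢l = third in
    ¬nonSplitting-if-fork B p (∈-++⁺ˡ {xs = edges B} (there (here refl))) (∈-++⁺ˡ {xs = edges B} (there (there (here refl))))
                          (∈-++⁺ʳ (edges B) l∈) (spoke-fork a≢b a≢l b≢l) ns
    where
    B = bridge a<r b<r a≢b

    third : ∃ λ l → spoke l ∈ edges p × a ≢ l × b ≢ l
    third with shareEdge⇒common B p (proj₁ ns)
    ... | e , e∈B , e∈p with leg-bridge a<r b<r a≢b e∈B | leg-bridge a′<r b′<r a′≢b′ (p⊆ e∈p)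
    ... | inj₁ ea | inj₁ ea′ = b′ , b′∈ , (λ { refl → a′≢b′ (trans (sym ea′) ea) })
                                        , (λ { refl → ≢straight (trans (sym ea) ea′ , refl) })
    ... | inj₁ ea | inj₂ eb′ = a′ , a′∈ , (λ { refl → a′≢b′ (trans (sym ea) eb′) })
                                        , (λ { refl → ≢crossed (trans (sym ea) eb′ , refl) })
    ... | inj₂ eb | inj₁ ea′ = b′ , b′∈ , (λ { refl → ≢crossed (refl , trans (sym eb) ea′) })
                                        , (λ { refl → a′≢b′ (trans (sym ea′) eb) })
    ... | inj₂ eb | inj₂ eb′ = a′ , a′∈ , (λ { refl → ≢straight (refl , trans (sym eb) eb′) })
                                        , (λ { refl → a′≢b′ (trans (sym eb) eb′) })

  outer-nonSplitting⇔ : ∀ {i} (i<r : i < r) p → NonSplitting (toPath (outerPath i<r)) (toPath p) ⇔ outer i ∈ edges p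
  outer-nonSplitting⇔ {i} i<r p =
    mk⇔ shared (λ o∈ → nonSplitting-within L p p (λ { (here refl) → o∈ }) (λ e∈ → e∈) (here refl) o∈)
    where
    L = outerPath i<r
    shared : NonSplitting (toPath L) (toPath p) → outer i ∈ edges p
    shared (share , _) with shareEdge⇒common L p share
    ... | _ , here refl , e∈p = e∈p

  outer-realises : ∀ {i k t₁ t₂ e} (i<r : i < r) p → e ∈ edges p → e ≢ outer i →
                   (outer i ∈ edges p ⇔ Consecutive k t₁ t₂) → Realises (outerPath i<r) p k t₁ t₂
  outer-realises i<r p e∈p e≢ iff = record
    { nonSplitting⇔consecutive = ⇔.trans (outer-nonSplitting⇔ i<r p) iff
    ; distinctPaths            = λ same →
        ¬samePath-if-missing p (outerPath i<r) e∈p (λ { (here eq) → e≢ eq ; (there ()) })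
                             (samePath-sym {P = toPath (outerPath i<r)} {Q = toPath p} same)
    }

  data Length : ℕ → Set where
    evenLength : Length (double r)
    oddLength  : Length (suc (double r))

  suc-double≢length : ∀ {k j} → Length k → j < r → suc (double j) ≢ k
  suc-double≢length evenLength _   eq = double≢suc-double r _ (sym eq)
  suc-double≢length oddLength  j<r eq = <⇒≢ j<r (double-injective (suc-injective eq))

  double-suc≢length : ∀ {k a} → Length k → a < q → double (suc a) ≢ k
  double-suc≢length evenLength a<q eq = <⇒≢ a<q (suc-injective (double-injective eq))
  double-suc≢length {a = a} oddLength _ eq = double≢suc-double (suc a) r eq

  q<r : q < r
  q<r = ≤-refl

  0<r : 0 < r
  0<r = s≤s z≤n

  q≢0 : q ≢ 0
  q≢0 ()

  module _ {a : ℕ} (a<q : a < q) where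

    bridgeAfter : ListPath
    bridgeAfter = bridge (m≤n⇒m≤1+n a<q) (s≤s a<q) (1+n≢n ∘ sym)

    outer∈bridgeAfter : ∀ {i} → outer i ∈ edges bridgeAfter ⇔ (i ≡ a ⊎ i ≡ suc a)
    outer∈bridgeAfter = outer∈bridge (m≤n⇒m≤1+n a<q) (s≤s a<q) (1+n≢n ∘ sym)

    bridgeAfter-apart : ∀ {a′ b′} (a′<r : a′ < r) (b′<r : b′ < r) (a′≢b′ : a′ ≢ b′) (p : ListPath) →
                        spoke a′ ∈ edges p → spoke b′ ∈ edges p → edges p ⊆ edges (bridge a′<r b′<r a′≢b′) →
                        ¬ (a ≡ a′ × suc a ≡ b′) → ¬ (a ≡ b′ × suc a ≡ a′) →
                        ¬ NonSplitting (toPath bridgeAfter) (toPath p)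
    bridgeAfter-apart = bridge-apart (m≤n⇒m≤1+n a<q) (s≤s a<q) (1+n≢n ∘ sym)

  closing closingˡ closingʳ : ListPath
  closing  = bridge q<r 0<r q≢0
  closingˡ = bridgeˡ q<r 0<r q≢0
  closingʳ = bridgeʳ q<r 0<r q≢0

  outer-outer : ∀ {k i j} → Length k → (i<r : i < r) (j<r : j < r) → i ≢ j →
                Realises (outerPath i<r) (outerPath j<r) k (double i) (double j)
  outer-outer {k} {i} {j} kind i<r j<r i≢j = realises-apart ¬ns ¬consecutive
    where
    ¬ns : ¬ NonSplitting (toPath (outerPath i<r)) (toPath (outerPath j<r))
    ¬ns ns with Equivalence.to (outer-nonSplitting⇔ i<r (outerPath j<r)) ns
    ... | here refl = i≢j refl

    ¬consecutive : ¬ Consecutive k (double i) (double j)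
    ¬consecutive cons with consecutive-even-even cons
    ... | inj₁ (_ , eq) = suc-double≢length kind j<r eq
    ... | inj₂ (_ , eq) = suc-double≢length kind i<r eq

  outer-bridge : ∀ {k i a} → Length k → (i<r : i < r) (a<q : a < q) →
                 Realises (outerPath i<r) (bridgeAfter a<q) k (double i) (suc (double a))
  outer-bridge {k} {i} {a} kind i<r a<q =
    outer-realises i<r (bridgeAfter a<q) (there (here refl)) (λ ()) (⇔.trans (outer∈bridgeAfter a<q) consecutive⇔)
    where
    consecutive⇔ : (i ≡ a ⊎ i ≡ suc a) ⇔ Consecutive k (double i) (suc (double a))
    consecutive⇔ = mk⇔ (λ { (inj₁ refl) → inj₁ refl ; (inj₂ refl) → inj₂ (inj₁ refl) }) from
      where
      from : Consecutive k (double i) (suc (double a)) → i ≡ a ⊎ i ≡ suc a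
      from cons with consecutive-even-odd cons
      ... | inj₁ eq               = inj₁ eq
      ... | inj₂ (inj₁ eq)        = inj₂ eq
      ... | inj₂ (inj₂ (_ , eq)) = ⊥-elim (double-suc≢length kind a<q eq)

  bridge-bridge : ∀ {k a b} (a<q : a < q) (b<q : b < q) → a ≢ b →
                  Realises (bridgeAfter a<q) (bridgeAfter b<q) k (suc (double a)) (suc (double b))
  bridge-bridge {a = a} a<q b<q a≢b =
    realises-apart (bridgeAfter-apart a<q (m≤n⇒m≤1+n b<q) (s≤s b<q) (1+n≢n ∘ sym) (bridgeAfter b<q)
                      (there (here refl)) (there (there (here refl))) (λ e∈ → e∈)
                      (λ (a≡b , _) → a≢b a≡b) (λ (a≡1+b , 1+a≡b) → n≢2+n a (trans a≡1+b (sym (cong suc 1+a≡b)))))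
                   consecutive-odd-odd

  bridge-apart-closing : ∀ {a} (a<q : a < q) p → spoke q ∈ edges p → spoke 0 ∈ edges p → edges p ⊆ edges closing →
                         ¬ NonSplitting (toPath (bridgeAfter a<q)) (toPath p)
  bridge-apart-closing a<q p q∈ 0∈ p⊆ =
    bridgeAfter-apart a<q q<r 0<r q≢0 p q∈ 0∈ p⊆ (λ (a≡q , _) → <⇒≢ a<q a≡q) (λ { (refl , ()) })

  outer-closing : ∀ {i} (i<r : i < r) → Realises (outerPath i<r) closing (double r) (double i) (suc (double q))
  outer-closing {i} i<r =
    outer-realises i<r closing (there (here refl)) (λ ()) (⇔.trans (outer∈bridge q<r 0<r q≢0) consecutive⇔)
    where
    consecutive⇔ : (i ≡ q ⊎ i ≡ 0) ⇔ Consecutive (double r) (double i) (suc (double q))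
    consecutive⇔ = mk⇔ (λ { (inj₁ refl) → inj₁ refl ; (inj₂ refl) → inj₂ (inj₂ (inj₁ (refl , refl))) }) from
      where
      from : Consecutive (double r) (double i) (suc (double q)) → i ≡ q ⊎ i ≡ 0
      from cons with consecutive-even-odd cons
      ... | inj₁ eq               = inj₁ eq
      ... | inj₂ (inj₁ eq)        = ⊥-elim (<⇒≢ i<r eq)
      ... | inj₂ (inj₂ (eq , _)) = inj₂ eq

  bridge-closing : ∀ {k a} (a<q : a < q) → Realises (bridgeAfter a<q) closing k (suc (double a)) (suc (double q))
  bridge-closing a<q =
    realises-apart (bridge-apart-closing a<q closing (there (here refl)) (there (there (here refl))) (λ e∈ → e∈))
                   consecutive-odd-odd

  outer-closingˡ : ∀ {i} (i<r : i < r) → Realises (outerPath i<r) closingˡ (suc (double r)) (double i) (suc (double q))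
  outer-closingˡ {i} i<r =
    outer-realises i<r closingˡ (there (here refl)) (λ ()) (⇔.trans (outer∈bridgeˡ q<r 0<r q≢0) consecutive⇔)
    where
    consecutive⇔ : i ≡ q ⇔ Consecutive (suc (double r)) (double i) (suc (double q))
    consecutive⇔ = mk⇔ (λ { refl → inj₁ refl }) from
      where
      from : Consecutive (suc (double r)) (double i) (suc (double q)) → i ≡ q
      from cons with consecutive-even-odd cons
      ... | inj₁ eq               = eq
      ... | inj₂ (inj₁ eq)        = ⊥-elim (<⇒≢ i<r eq)
      ... | inj₂ (inj₂ (_ , eq)) = ⊥-elim (double≢suc-double r r eq)

  outer-closingʳ : ∀ {i} (i<r : i < r) → Realises (outerPath i<r) closingʳ (suc (double r)) (double i) (double r)
  outer-closingʳ {i} i<r =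
    outer-realises i<r closingʳ (here refl) (λ ()) (⇔.trans (outer∈bridgeʳ q<r 0<r q≢0) consecutive⇔)
    where
    consecutive⇔ : i ≡ 0 ⇔ Consecutive (suc (double r)) (double i) (double r)
    consecutive⇔ = mk⇔ (λ { refl → inj₂ (inj₂ (inj₁ (refl , refl))) }) from
      where
      from : Consecutive (suc (double r)) (double i) (double r) → i ≡ 0
      from cons with consecutive-even-even cons
      ... | inj₁ (eq , _) = eq
      ... | inj₂ (() , _)

  bridge-closingˡ : ∀ {k a} (a<q : a < q) → Realises (bridgeAfter a<q) closingˡ k (suc (double a)) (suc (double q))
  bridge-closingˡ a<q =
    realises-apart (bridge-apart-closing a<q closingˡ (there (here refl)) (there (there (here refl)))
                      (λ { (here refl) → here refl ; (there (here refl)) → there (here refl)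
                         ; (there (there (here refl))) → there (there (here refl)) }))
                   consecutive-odd-odd

  bridge-closingʳ : ∀ {a} (a<q : a < q) → Realises (bridgeAfter a<q) closingʳ (suc (double r)) (suc (double a)) (double r)
  bridge-closingʳ {a} a<q =
    realises-apart (bridge-apart-closing a<q closingʳ (here refl) (there (here refl))
                      (λ { (here refl) → there (here refl) ; (there (here refl)) → there (there (here refl))
                         ; (there (there (here refl))) → there (there (there (here refl))) }))
                   ¬consecutive
    where
    ¬consecutive : ¬ Consecutive (suc (double r)) (suc (double a)) (double r)
    ¬consecutive cons with consecutive-even-odd (consecutive-sym cons)
    ... | inj₁ eq               = <⇒≢ (m≤n⇒m≤1+n a<q) (sym eq)
    ... | inj₂ (inj₁ eq)        = <⇒≢ a<q (sym (suc-injective eq))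
    ... | inj₂ (inj₂ (() , _))

  closingˡ-closingʳ : Realises closingˡ closingʳ (suc (double r)) (suc (double q)) (double r)
  closingˡ-closingʳ =
    realises-adjacent
      (nonSplitting-within closingˡ closingʳ closing
         (λ { (here refl) → here refl ; (there (here refl)) → there (here refl)
            ; (there (there (here refl))) → there (there (here refl)) })
         (λ { (here refl) → there (here refl) ; (there (here refl)) → there (there (here refl))
            ; (there (there (here refl))) → there (there (there (here refl))) })
         (there (here refl)) (here refl))
      (inj₁ refl)
      (¬samePath-if-missing closingˡ closingʳ (here refl)
         (λ { (here ()) ; (there (here ())) ; (there (there (here ()))) ; (there (there (there ()))) }))

  module Even where

    data Position : ℕ → Set where
      outerAt   : ∀ {i} → i < r → Position (double i)
      bridgeAt  : ∀ {a} → a < q → Position (suc (double a))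
      closingAt : Position (suc (double q))

    position : ∀ t → t < double r → Position t
    position t t<k with parity t
    ... | even i = outerAt (s≤s (double-cancel-≤ (≤-pred t<k)))
    ... | odd a with m≤n⇒m<n∨m≡n (double-cancel-≤ (m≤n⇒m≤1+n (≤-pred (≤-pred t<k))))
    ...   | inj₁ a<q = bridgeAt a<q
    ...   | inj₂ refl = closingAt

    pathAt : ∀ {t} → Position t → ListPath
    pathAt (outerAt i<r)  = outerPath i<r
    pathAt (bridgeAt a<q) = bridgeAfter a<q
    pathAt closingAt      = closing

    realisesAt : ∀ {t₁ t₂} (u : Position t₁) (v : Position t₂) → t₁ ≢ t₂ →
                 Realises (pathAt u) (pathAt v) (double r) t₁ t₂
    realisesAt (outerAt i<r)  (outerAt j<r)  t₁≢t₂ = outer-outer evenLength i<r j<r (t₁≢t₂ ∘ cong double)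
    realisesAt (outerAt i<r)  (bridgeAt a<q) _     = outer-bridge evenLength i<r a<q
    realisesAt (outerAt i<r)  closingAt      _     = outer-closing i<r
    realisesAt (bridgeAt a<q) (outerAt i<r)  _     = realises-sym (outer-bridge evenLength i<r a<q)
    realisesAt (bridgeAt a<q) (bridgeAt b<q) t₁≢t₂ = bridge-bridge a<q b<q (t₁≢t₂ ∘ cong (suc ∘ double))
    realisesAt (bridgeAt a<q) closingAt      _     = bridge-closing a<q
    realisesAt closingAt      (outerAt i<r)  _     = realises-sym (outer-closing i<r)
    realisesAt closingAt      (bridgeAt a<q) _     = realises-sym (bridge-closing a<q)
    realisesAt closingAt      closingAt      t₁≢t₂ = ⊥-elim (t₁≢t₂ refl)

    paths : Fin (double r) → ListPath
    paths u = pathAt (position (toℕ u) (toℕ<n u))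

    enpt : ENPTIso T (double r) (toPath ∘ paths) (double r) (CycAdj (double r))
    enpt = realises⇒ENPT paths (λ u v u≢v → realisesAt _ _ (u≢v ∘ toℕ-injective))

  module Odd where

    data Position : ℕ → Set where
      outerAt    : ∀ {i} → i < r → Position (double i)
      bridgeAt   : ∀ {a} → a < q → Position (suc (double a))
      closingˡAt : Position (suc (double q))
      closingʳAt : Position (double r)

    position : ∀ t → t < suc (double r) → Position t
    position t t<k with parity t
    ... | even i with m≤n⇒m<n∨m≡n (double-cancel-≤ (m≤n⇒m≤1+n (≤-pred t<k)))
    ...   | inj₁ i<r = outerAt i<r
    ...   | inj₂ refl = closingʳAt
    position t t<k | odd a with m≤n⇒m<n∨m≡n (double-cancel-≤ (≤-pred (≤-pred t<k)))
    ...   | inj₁ a<q = bridgeAt a<q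
    ...   | inj₂ refl = closingˡAt

    pathAt : ∀ {t} → Position t → ListPath
    pathAt (outerAt i<r)  = outerPath i<r
    pathAt (bridgeAt a<q) = bridgeAfter a<q
    pathAt closingˡAt     = closingˡ
    pathAt closingʳAt     = closingʳ

    realisesAt : ∀ {t₁ t₂} (u : Position t₁) (v : Position t₂) → t₁ ≢ t₂ →
                 Realises (pathAt u) (pathAt v) (suc (double r)) t₁ t₂
    realisesAt (outerAt i<r)  (outerAt j<r)  t₁≢t₂ = outer-outer oddLength i<r j<r (t₁≢t₂ ∘ cong double)
    realisesAt (outerAt i<r)  (bridgeAt a<q) _     = outer-bridge oddLength i<r a<q
    realisesAt (outerAt i<r)  closingˡAt     _     = outer-closingˡ i<r
    realisesAt (outerAt i<r)  closingʳAt     _     = outer-closingʳ i<r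
    realisesAt (bridgeAt a<q) (outerAt i<r)  _     = realises-sym (outer-bridge oddLength i<r a<q)
    realisesAt (bridgeAt a<q) (bridgeAt b<q) t₁≢t₂ = bridge-bridge a<q b<q (t₁≢t₂ ∘ cong (suc ∘ double))
    realisesAt (bridgeAt a<q) closingˡAt     _     = bridge-closingˡ a<q
    realisesAt (bridgeAt a<q) closingʳAt     _     = bridge-closingʳ a<q
    realisesAt closingˡAt     (outerAt i<r)  _     = realises-sym (outer-closingˡ i<r)
    realisesAt closingˡAt     (bridgeAt a<q) _     = realises-sym (bridge-closingˡ a<q)
    realisesAt closingˡAt     closingˡAt     t₁≢t₂ = ⊥-elim (t₁≢t₂ refl)
    realisesAt closingˡAt     closingʳAt     _     = closingˡ-closingʳ
    realisesAt closingʳAt     (outerAt i<r)  _     = realises-sym (outer-closingʳ i<r)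
    realisesAt closingʳAt     (bridgeAt a<q) _     = realises-sym (bridge-closingʳ a<q)
    realisesAt closingʳAt     closingˡAt     _     = realises-sym closingˡ-closingʳ
    realisesAt closingʳAt     closingʳAt     t₁≢t₂ = ⊥-elim (t₁≢t₂ refl)

    paths : Fin (suc (double r)) → ListPath
    paths u = pathAt (position (toℕ u) (toℕ<n u))

    enpt : ENPTIso T (suc (double r)) (toPath ∘ paths) (suc (double r)) (CycAdj (suc (double r)))
    enpt = realises⇒ENPT paths (λ u v u≢v → realisesAt _ _ (u≢v ∘ toℕ-injective))

lemma3 : ∀ (k : ℕ) → k ≥ 3 →
    ∃ λ (m : ℕ) → Σ (Graph m) λ T → IsTree T ×
    ∃ λ (n : ℕ) → Σ (Fin n → Path T) λ P → ENPTIso T n P k (CycAdj k)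
lemma3 0 ()
lemma3 1 (s≤s ())
lemma3 2 (s≤s (s≤s ()))
lemma3 3 _ = _ , C₃.T , C₃.isTree ≤-refl , 3 , C₃.toPath ∘ C₃.paths , C₃.enpt
lemma3 4 _ = _ , C₄.T , C₄.isTree ≤-refl , 4 , C₄.toPath ∘ C₄.paths , C₄.enpt
lemma3 5 _ = _ , C₅.T , C₅.isTree (s≤s z≤n) , 5 , C₅.toPath ∘ C₅.paths , C₅.enpt
lemma3 (suc (suc (suc (suc (suc (suc s)))))) _ with parity s
... | even h = let open LongCycle h in _ , T , isTree (s≤s z≤n) , _ , toPath ∘ Even.paths , Even.enpt
... | odd h  = let open LongCycle h in _ , T , isTree (s≤s z≤n) , _ , toPath ∘ Odd.paths , Odd.enpt
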